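{- $\mathrm{DET{:}LD}(K)\ge \frac{3}{11}$; that is, every DET:LD set on the infinite king grid $K$ has density at least $\frac{3}{11}$.
   Context: The infinite king grid $K$ has vertex set $\mathbb{Z}^2$, with distinct vertices $(a,b),(c,d)$ adjacent iff $\max(|a-c|,|b-d|)=1$. $N(v)$ is the open neighborhood of $v$ and $N[v]=N(v)\cup\{v\}$. A set $S\subseteq V(K)$ is a DET:LD (error-detecting locating-dominating) set iff (i) for all $v\in V(K)$, $|N[v]\cap S|\ge 2$; (ii) for all distinct $u,v\in S$, $|(N(v)\cap S)\triangle(N(u)\cap S)|\ge 1$; (iii) for all $v\in V(K)\setminus S$ and $u\in S$, $|(N(v)\cap S)\setminus(N(u)\cap S)|\ge 2$ or $|(N(u)\cap S)\setminus(N(v)\cap S)|\ge 1$; (iv) for all distinct $u,v\in V(K)\setminus S$, $|(N(v)\cap S)\setminus(N(u)\cap S)|\ge 2$ or $|(N(u)\cap S)\setminus(N(v)\cap S)|\ge 2$. The density of $S$ is $\limsup_{n\to\infty}|S\cap Q_n|/|Q_n|$ with $Q_n=\{ -n,\dots,n\}^2$, and $\mathrm{DET{:}LD}(K)$ is the infimum of densities of DET:LD sets on $K$. -}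

module Defs where

open import Data.Bool using (Bool; true; false; _∧_; not; if_then_else_)
open import Data.Nat as ℕ using (ℕ; suc; _+_; _*_; _≤_; _⊔_; _≡ᵇ_)
open import Data.Integer as ℤ using (ℤ; +_; ∣_∣)
open import Data.Product using (_×_; _,_; ∃-syntax)
open import Data.List using (List; []; _∷_; map; filter; length; upTo; concatMap)
open import Relation.Binary.PropositionalEquality using (_≡_)
open import Relation.Nullary using (¬_)
open import Data.Sum using (_⊎_)
open import Function using (_∘_)
open import Relation.Nullary.Decidable using (Dec; yes; no)
open import Data.Bool.Properties using () renaming (_≟_ to _≟B_)

Pt : Set
Pt = ℤ × ℤ

Subset : Set
Subset = Pt → Bool

_∈S_ : Pt → Subset → Set
v ∈S S = S v ≡ true

_∉S_ : Pt → Subset → Set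
v ∉S S = S v ≡ false

adjᵇ : Pt → Pt → Bool
adjᵇ (a , b) (c , d) = (∣ a ℤ.- c ∣ ⊔ ∣ b ℤ.- d ∣) ≡ᵇ 1

nbrs : Pt → List Pt
nbrs (a , b) =
  (a ℤ.+ ℤ.-1ℤ , b ℤ.+ ℤ.-1ℤ) ∷ (a ℤ.+ ℤ.-1ℤ , b) ∷ (a ℤ.+ ℤ.-1ℤ , b ℤ.+ ℤ.1ℤ) ∷
  (a , b ℤ.+ ℤ.-1ℤ) ∷ (a , b ℤ.+ ℤ.1ℤ) ∷
  (a ℤ.+ ℤ.1ℤ , b ℤ.+ ℤ.-1ℤ) ∷ (a ℤ.+ ℤ.1ℤ , b) ∷ (a ℤ.+ ℤ.1ℤ , b ℤ.+ ℤ.1ℤ) ∷ []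

isTrue : (b : Bool) → Dec (b ≡ true)
isTrue b = b ≟B true

nbrCount : Subset → Pt → ℕ
nbrCount S v = length (filter (λ w → isTrue (S w)) (nbrs v))

closedCount : Subset → Pt → ℕ
closedCount S v = (if S v then 1 else 0) + nbrCount S v

-- |(N(v) ∩ S) \ (N(u) ∩ S)|
diffCount : Subset → Pt → Pt → ℕ
diffCount S v u = length (filter (λ w → isTrue (S w ∧ not (adjᵇ u w))) (nbrs v))

record IsDETLD (S : Subset) : Set where
  field
    dom  : ∀ v → 2 ≤ closedCount S v
    sep₁ : ∀ u v → u ∈S S → v ∈S S → ¬ (u ≡ v) → 1 ≤ diffCount S v u + diffCount S u v
    sep₂ : ∀ v u → v ∉S S → u ∈S S → (2 ≤ diffCount S v u) ⊎ (1 ≤ diffCount S u v)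
    sep₃ : ∀ u v → u ∉S S → v ∉S S → ¬ (u ≡ v) → (2 ≤ diffCount S v u) ⊎ (2 ≤ diffCount S u v)

range : ℕ → List ℤ
range n = map (λ i → (+ i) ℤ.- (+ n)) (upTo (suc (2 * n)))

box : ℕ → List Pt
box n = concatMap (λ x → map (x ,_) (range n)) (range n)

countIn : Subset → ℕ → ℕ
countIn S n = length (filter (λ w → isTrue (S w)) (box n))

boxSize : ℕ → ℕ
boxSize n = suc (2 * n) * suc (2 * n)

-- limsup_{n→∞} |S ∩ Q_n| / |Q_n| ≥ p / q   (q > 0), unfolded:
-- for every ε = 1/(k+1) and every N there is n ≥ N with
-- |S ∩ Q_n| / |Q_n| ≥ p/q − 1/(k+1), i.e. (cleared of denominators, in ℕ)
-- p (k+1) |Q_n| ≤ q (k+1) |S ∩ Q_n| + q |Q_n|.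
DensityAtLeast : Subset → ℕ → ℕ → Set
DensityAtLeast S p q =
  ∀ (k N : ℕ) → ∃[ n ] (N ≤ n × p * suc k * boxSize n ≤ q * suc k * countIn S n + q * boxSize n)

{-# OPTIONS --safe #-}
-- Discharging. Call v tight if |N[v] ∩ S| = 2 and let every vertex v send 2 + [v tight] to each
-- vertex of N[v] ∩ S, so that it sends at least 6. A vertex s ∈ S receives from the nine vertices
-- of N[s]: 2 from each, and 1 more from s itself if tight, from at most one tight neighbour outside
-- S (two such u, v both see s, so neither has two S-neighbours the other lacks, against (iv)) and
-- from at most one tight neighbour in S (both would have N(·) ∩ S = {s}, against (ii)). Hence s
-- receives at most 21, and as all charge sent from Q_n stays in Q_{n+1},
-- 6 |Q_n| ≤ 21 |S ∩ Q_{n+1}|: the density is at least 2/7 > 3/11.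
module Submission where

open import Defs
open import Data.Bool using (Bool; true; false; _∧_; not; if_then_else_)
open import Data.Bool.Properties using (T-≡)
open import Data.Nat using (ℕ; zero; suc; _+_; _*_; _≤_; _<_; _⊔_; _≡ᵇ_; z≤n; s≤s; s≤s⁻¹)
open import Data.Nat.Properties
open import Data.Integer as ℤ using (ℤ; ∣_∣)
import Data.Integer.Properties as ℤ
open import Data.Product using (_,_; _×_; proj₁; proj₂)
open import Data.Product.Properties using (≡-dec)
open import Data.Sum using (inj₁; inj₂)
open import Data.Empty using (⊥-elim)
open import Data.List using (List; []; _∷_; _++_; applyUpTo; concatMap; filter; length; map)
open import Data.List.Properties using (length-map; length-applyUpTo; map-applyUpTo)
open import Data.List.Membership.Propositional using (_∈_)
open import Data.List.Membership.Propositional.Properties using (∈-map⁺)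
open import Data.List.Relation.Unary.All as All using (All; []; _∷_)
open import Data.List.Relation.Unary.Any using (here; there)
open import Data.List.Relation.Unary.Unique.Propositional using (Unique)
open import Data.List.Relation.Unary.AllPairs using ([]; _∷_)
open import Data.List.Relation.Unary.Unique.DecPropositional (≡-dec ℤ._≟_ ℤ._≟_) using (unique?)
open import Data.List.Relation.Binary.Sublist.Propositional using (_⊆_; []; _∷_; _∷ʳ_; minimum)
open import Function using (_∘_; id; _$_)
open import Function.Bundles using (Equivalence)
open import Relation.Binary.PropositionalEquality
open import Relation.Nullary using (Dec; yes; no; contradiction)
open import Relation.Nullary.Decidable using (from-yes)
open import Algebra.Properties.CommutativeSemigroup +-commutativeSemigroup
  using () renaming (interchange to +-interchange)
open import Algebra.Properties.CommutativeSemigroup *-commutativeSemigroup using (xy∙z≈y∙xz; x∙yz≈y∙xz)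
import Data.Integer.Tactic.RingSolver as ℤ-Solver
import Data.Nat.Tactic.RingSolver as ℕ-Solver

private
  variable
    A B : Set

-- Written with if_then_else_ so that closedCount S v is definitionally toℕ (S v) + nbrCount S v.
toℕ : Bool → ℕ
toℕ b = if b then 1 else 0

toℕ≤1 : ∀ b → toℕ b ≤ 1
toℕ≤1 true  = ≤-refl
toℕ≤1 false = z≤n

∧≡true : ∀ {a b} → a ∧ b ≡ true → a ≡ true × b ≡ true
∧≡true {true} {true} _ = refl , refl

not≡true : ∀ {a} → not a ≡ true → a ≡ false
not≡true {false} _ = refl

_≟ₚ_ : (u v : Pt) → Dec (u ≡ v)
_≟ₚ_ = ≡-dec ℤ._≟_ ℤ._≟_

∑ : List A → (A → ℕ) → ℕ
∑ []       f = 0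
∑ (x ∷ xs) f = f x + ∑ xs f

syntax ∑ xs (λ x → e) = ∑[ x ∈ xs ] e

∑-cong : ∀ xs {f g : A → ℕ} → (∀ x → f x ≡ g x) → ∑ xs f ≡ ∑ xs g
∑-cong []       eq = refl
∑-cong (x ∷ xs) eq = cong₂ _+_ (eq x) (∑-cong xs eq)

∑-mono-≤ : ∀ xs {f g : A → ℕ} → (∀ x → f x ≤ g x) → ∑ xs f ≤ ∑ xs g
∑-mono-≤ []       le = z≤n
∑-mono-≤ (x ∷ xs) le = +-mono-≤ (le x) (∑-mono-≤ xs le)

∑-mono-⊆ : ∀ {xs ys} (f : A → ℕ) → xs ⊆ ys → ∑ xs f ≤ ∑ ys f
∑-mono-⊆ f []          = z≤n
∑-mono-⊆ f (y ∷ʳ xs⊆ys) = ≤-trans (∑-mono-⊆ f xs⊆ys) (m≤n+m _ (f y))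
∑-mono-⊆ f (refl ∷ xs⊆ys) = +-monoʳ-≤ _ (∑-mono-⊆ f xs⊆ys)

∑-distrib-+ : ∀ xs (f g : A → ℕ) → ∑[ x ∈ xs ] (f x + g x) ≡ ∑ xs f + ∑ xs g
∑-distrib-+ []       f g = refl
∑-distrib-+ (x ∷ xs) f g = trans (cong (f x + g x +_) (∑-distrib-+ xs f g)) (+-interchange (f x) (g x) _ _)

∑-*ˡ : ∀ xs c (f : A → ℕ) → ∑[ x ∈ xs ] (c * f x) ≡ c * ∑ xs f
∑-*ˡ []       c f = sym (*-zeroʳ c)
∑-*ˡ (x ∷ xs) c f = trans (cong (c * f x +_) (∑-*ˡ xs c f)) (sym (*-distribˡ-+ c (f x) _))

∑-*ʳ : ∀ xs c (f : A → ℕ) → ∑[ x ∈ xs ] (f x * c) ≡ ∑ xs f * c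
∑-*ʳ xs c f = trans (∑-cong xs (λ x → *-comm (f x) c)) (trans (∑-*ˡ xs c f) (*-comm c _))

∑-const : ∀ (xs : List A) c → ∑[ x ∈ xs ] c ≡ c * length xs
∑-const []       c = sym (*-zeroʳ c)
∑-const (x ∷ xs) c = trans (cong (c +_) (∑-const xs c)) (sym (*-suc c (length xs)))

∑-++ : ∀ xs ys (f : A → ℕ) → ∑ (xs ++ ys) f ≡ ∑ xs f + ∑ ys f
∑-++ []       ys f = refl
∑-++ (x ∷ xs) ys f = trans (cong (f x +_) (∑-++ xs ys f)) (sym (+-assoc (f x) _ _))

∑-map : ∀ xs (g : A → B) (f : B → ℕ) → ∑ (map g xs) f ≡ ∑ xs (f ∘ g)
∑-map []       g f = refl
∑-map (x ∷ xs) g f = cong (f (g x) +_) (∑-map xs g f)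

∑-concatMap : ∀ xs (g : A → List B) (f : B → ℕ) → ∑ (concatMap g xs) f ≡ ∑[ x ∈ xs ] ∑ (g x) f
∑-concatMap []       g f = refl
∑-concatMap (x ∷ xs) g f = trans (∑-++ (g x) _ f) (cong (∑ (g x) f +_) (∑-concatMap xs g f))

module _ (p : A → Bool) where

  length-filter≡∑ : ∀ xs → length (filter (isTrue ∘ p) xs) ≡ ∑ xs (toℕ ∘ p)
  length-filter≡∑ []       = refl
  length-filter≡∑ (x ∷ xs) with p x
  ... | true  = cong suc (length-filter≡∑ xs)
  ... | false = length-filter≡∑ xs

  ∑-toℕ≡0 : ∀ xs → (∀ {y} → y ∈ xs → p y ≢ true) → ∑ xs (toℕ ∘ p) ≡ 0
  ∑-toℕ≡0 []       _ = refl
  ∑-toℕ≡0 (y ∷ xs) h with p y in eq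
  ... | true  = ⊥-elim (h (here refl) eq)
  ... | false = ∑-toℕ≡0 xs (h ∘ there)

  ∑-toℕ≤1 : ∀ xs → Unique xs → (∀ {x y} → x ∈ xs → y ∈ xs → p x ≡ true → p y ≡ true → x ≡ y) →
            ∑ xs (toℕ ∘ p) ≤ 1
  ∑-toℕ≤1 []       _            _ = z≤n
  ∑-toℕ≤1 (x ∷ xs) (x∉xs ∷ uniq) h with p x in eq
  ... | false = ∑-toℕ≤1 xs uniq (λ x∈ y∈ → h (there x∈) (there y∈))
  ... | true  = ≤-reflexive (cong suc (∑-toℕ≡0 xs λ y∈ py →
                  All.lookup x∉xs y∈ (h (here refl) (there y∈) eq py)))

toℕ-∧-≤ : ∀ a b → toℕ (a ∧ b) ≤ toℕ a
toℕ-∧-≤ true  true  = ≤-refl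
toℕ-∧-≤ true  false = z≤n
toℕ-∧-≤ false b     = z≤n

∑-toℕ-∧-not< : ∀ {x xs} (p q : A → Bool) → x ∈ xs → p x ≡ true → q x ≡ true →
               ∑[ w ∈ xs ] toℕ (p w ∧ not (q w)) < ∑ xs (toℕ ∘ p)
∑-toℕ-∧-not< {xs = _ ∷ xs} p q (here refl) px qx rewrite px | qx =
  s≤s (∑-mono-≤ xs (λ w → toℕ-∧-≤ (p w) _))
∑-toℕ-∧-not< {xs = y ∷ _} p q (there x∈) px qx =
  +-mono-≤-< (toℕ-∧-≤ (p y) _) (∑-toℕ-∧-not< p q x∈ px qx)

applyUpTo-⊆ : ∀ {f g : ℕ → A} k j m → (∀ i → f i ≡ g (k + i)) →
              applyUpTo f m ⊆ applyUpTo g (k + j + m)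
applyUpTo-⊆ {f = f} {g} k j m eq =
  subst (λ l → applyUpTo f m ⊆ applyUpTo g l)
        (trans (cong (k +_) (+-comm m j)) (sym (+-assoc k j m))) (go k m eq)
  where
  go : ∀ {f g : ℕ → A} k m → (∀ i → f i ≡ g (k + i)) → applyUpTo f m ⊆ applyUpTo g (k + (m + j))
  go {g = g} (suc k) m       eq = g 0 ∷ʳ go k m eq
  go         zero    zero    eq = minimum _
  go         zero    (suc m) eq = eq 0 ∷ go zero m (eq ∘ suc)

coordinate : ℕ → ℕ → ℤ
coordinate n i = ℤ.+ i ℤ.- ℤ.+ n

range≡applyUpTo : ∀ n → range n ≡ applyUpTo (coordinate n) (suc (2 * n))
range≡applyUpTo n = map-applyUpTo id (coordinate n) (suc (2 * n))

range-+-⊆ : ∀ n {d} → ∣ d ∣ ≤ 1 → map (ℤ._+ d) (range n) ⊆ range (suc n)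
range-+-⊆ n {d} ∣d∣≤1 = subst₂ _⊆_
  (sym (trans (cong (map (ℤ._+ d)) (range≡applyUpTo n)) (map-applyUpTo (coordinate n) (ℤ._+ d) m)))
  (sym (trans (range≡applyUpTo (suc n)) (cong (λ l → applyUpTo (coordinate (suc n)) (suc l)) (*-suc 2 n))))
  (unit-step d ∣d∣≤1)
  where
  m = suc (2 * n)
  unit-step : ∀ d → ∣ d ∣ ≤ 1 →
              applyUpTo (λ i → coordinate n i ℤ.+ d) m ⊆ applyUpTo (coordinate (suc n)) (2 + m)
  unit-step ℤ.-[1+ 0 ]        _ = applyUpTo-⊆ {g = coordinate (suc n)} 0 2 m λ i → step₋ (ℤ.+ i) (ℤ.+ n)
    where
    step₋ : ∀ a b → a ℤ.- b ℤ.+ ℤ.-1ℤ ≡ a ℤ.- (ℤ.1ℤ ℤ.+ b)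
    step₋ = ℤ-Solver.solve-∀
  unit-step (ℤ.+ 0)           _ = applyUpTo-⊆ {g = coordinate (suc n)} 1 1 m λ i → step₀ (ℤ.+ i) (ℤ.+ n)
    where
    step₀ : ∀ a b → a ℤ.- b ℤ.+ ℤ.0ℤ ≡ (ℤ.1ℤ ℤ.+ a) ℤ.- (ℤ.1ℤ ℤ.+ b)
    step₀ = ℤ-Solver.solve-∀
  unit-step (ℤ.+ 1)           _ = applyUpTo-⊆ {g = coordinate (suc n)} 2 0 m λ i → step₊ (ℤ.+ i) (ℤ.+ n)
    where
    step₊ : ∀ a b → a ℤ.- b ℤ.+ ℤ.1ℤ ≡ (ℤ.1ℤ ℤ.+ (ℤ.1ℤ ℤ.+ a)) ℤ.- (ℤ.1ℤ ℤ.+ b)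
    step₊ = ℤ-Solver.solve-∀
  unit-step ℤ.-[1+ suc _ ]    (s≤s ())
  unit-step (ℤ.+ suc (suc _)) (s≤s ())

_⊕_ : Pt → Pt → Pt
(a , b) ⊕ (c , d) = (a ℤ.+ c , b ℤ.+ d)

_⊖_ : Pt → Pt → Pt
(a , b) ⊖ (c , d) = (a ℤ.- c , b ℤ.- d)

‖_‖ : Pt → ℕ
‖ (a , b) ‖ = ∣ a ∣ ⊔ ∣ b ∣

⊕-identityʳ : ∀ v → v ⊕ (ℤ.0ℤ , ℤ.0ℤ) ≡ v
⊕-identityʳ (a , b) = cong₂ _,_ (ℤ.+-identityʳ a) (ℤ.+-identityʳ b)

⊕-⊖ : ∀ v o → (v ⊕ o) ⊖ o ≡ v
⊕-⊖ (a , b) (c , d) = cong₂ _,_ (cancel a c) (cancel b d)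
  where
  cancel : ∀ x y → x ℤ.+ y ℤ.- y ≡ x
  cancel = ℤ-Solver.solve-∀

⊖-⊕ : ∀ v o → (v ⊖ o) ⊕ o ≡ v
⊖-⊕ (a , b) (c , d) = cong₂ _,_ (cancel a c) (cancel b d)
  where
  cancel : ∀ x y → x ℤ.- y ℤ.+ y ≡ x
  cancel = ℤ-Solver.solve-∀

⊖-injectiveʳ : ∀ v {o o′} → v ⊖ o ≡ v ⊖ o′ → o ≡ o′
⊖-injectiveʳ (a , b) eq = cong₂ _,_ (cancel a (cong proj₁ eq)) (cancel b (cong proj₂ eq))
  where
  cancel : ∀ x {y y′} → x ℤ.- y ≡ x ℤ.- y′ → y ≡ y′
  cancel x {y} {y′} eq = begin
    y                   ≡⟨ twice x y ⟩
    x ℤ.- (x ℤ.- y)     ≡⟨ cong (λ z → x ℤ.- z) eq ⟩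
    x ℤ.- (x ℤ.- y′)    ≡⟨ twice x y′ ⟨
    y′                  ∎
    where
    open ≡-Reasoning
    twice : ∀ x y → y ≡ x ℤ.- (x ℤ.- y)
    twice = ℤ-Solver.solve-∀

‖v⊖o⊖v‖≡‖o‖ : ∀ v o → ‖ (v ⊖ o) ⊖ v ‖ ≡ ‖ o ‖
‖v⊖o⊖v‖≡‖o‖ (a , b) (c , d) = cong₂ _⊔_ (∣back∣ a c) (∣back∣ b d)
  where
  back : ∀ x y → x ℤ.- y ℤ.- x ≡ ℤ.- y
  back = ℤ-Solver.solve-∀
  ∣back∣ : ∀ x y → ∣ x ℤ.- y ℤ.- x ∣ ≡ ∣ y ∣
  ∣back∣ x y = trans (cong ∣_∣ (back x y)) (ℤ.∣-i∣≡∣i∣ y)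

∑-box : ∀ n (g : Pt → ℕ) → ∑ (box n) g ≡ ∑[ x ∈ range n ] ∑[ y ∈ range n ] g (x , y)
∑-box n g = trans (∑-concatMap (range n) (λ x → map (x ,_) (range n)) g)
                  (∑-cong (range n) λ x → ∑-map (range n) (x ,_) g)

∑-box-const : ∀ n c → ∑[ v ∈ box n ] c ≡ c * boxSize n
∑-box-const n c = begin
  ∑[ v ∈ box n ] c                              ≡⟨ ∑-box n (λ _ → c) ⟩
  ∑[ x ∈ range n ] ∑[ y ∈ range n ] c           ≡⟨ ∑-cong (range n) (λ _ → ∑-const (range n) c) ⟩
  ∑[ x ∈ range n ] (c * length (range n))        ≡⟨ ∑-const (range n) _ ⟩
  c * length (range n) * length (range n)         ≡⟨ cong (λ l → c * l * l) length-range ⟩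
  c * suc (2 * n) * suc (2 * n)                   ≡⟨ *-assoc c _ _ ⟩
  c * boxSize n                                   ∎
  where
  open ≡-Reasoning
  length-range : length (range n) ≡ suc (2 * n)
  length-range = trans (length-map (coordinate n) (applyUpTo id (suc (2 * n))))
                       (length-applyUpTo id (suc (2 * n)))

∑-box-⊕ : ∀ n (g : Pt → ℕ) {o} → ‖ o ‖ ≤ 1 → ∑[ v ∈ box n ] g (v ⊕ o) ≤ ∑ (box (suc n)) g
∑-box-⊕ n g {dx , dy} ‖o‖≤1 = begin
  ∑[ v ∈ box n ] g (v ⊕ (dx , dy))                                    ≡⟨ ∑-box n _ ⟩
  ∑[ x ∈ range n ] ∑[ y ∈ range n ] g (x ℤ.+ dx , y ℤ.+ dy)           ≡⟨ shifted ⟨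
  ∑[ x ∈ map (ℤ._+ dx) (range n) ] ∑[ y ∈ map (ℤ._+ dy) (range n) ] g (x , y)
    ≤⟨ ∑-mono-≤ (map (ℤ._+ dx) (range n)) (λ x → ∑-mono-⊆ (λ y → g (x , y)) (range-+-⊆ n ∣dy∣≤1)) ⟩
  ∑[ x ∈ map (ℤ._+ dx) (range n) ] ∑[ y ∈ range (suc n) ] g (x , y)
    ≤⟨ ∑-mono-⊆ _ (range-+-⊆ n ∣dx∣≤1) ⟩
  ∑[ x ∈ range (suc n) ] ∑[ y ∈ range (suc n) ] g (x , y)            ≡⟨ ∑-box (suc n) g ⟨
  ∑ (box (suc n)) g                                                   ∎
  where
  open ≤-Reasoning
  ∣dx∣≤1 = ≤-trans (m≤m⊔n ∣ dx ∣ ∣ dy ∣) ‖o‖≤1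
  ∣dy∣≤1 = ≤-trans (m≤n⊔m ∣ dx ∣ ∣ dy ∣) ‖o‖≤1
  shifted : ∑[ x ∈ map (ℤ._+ dx) (range n) ] ∑[ y ∈ map (ℤ._+ dy) (range n) ] g (x , y)
          ≡ ∑[ x ∈ range n ] ∑[ y ∈ range n ] g (x ℤ.+ dx , y ℤ.+ dy)
  shifted = trans (∑-map (range n) (ℤ._+ dx) _) (∑-cong (range n) λ x → ∑-map (range n) (ℤ._+ dy) _)

∑-box-double-count : ∀ n (h : Pt → Pt → ℕ) {os} → All (λ o → ‖ o ‖ ≤ 1) os →
  ∑[ v ∈ box n ] ∑[ o ∈ os ] h v (v ⊕ o) ≤ ∑[ s ∈ box (suc n) ] ∑[ o ∈ os ] h (s ⊖ o) s
∑-box-double-count n h [] = subst (_≤ ∑[ s ∈ box (suc n) ] 0) (sym (∑-box-const n 0)) z≤n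
∑-box-double-count n h {o ∷ os} (‖o‖≤1 ∷ ‖os‖≤1) = begin
  ∑[ v ∈ box n ] (h v (v ⊕ o) + ∑[ o′ ∈ os ] h v (v ⊕ o′))
    ≡⟨ ∑-distrib-+ (box n) (λ v → h v (v ⊕ o)) (λ v → ∑[ o′ ∈ os ] h v (v ⊕ o′)) ⟩
  ∑[ v ∈ box n ] h v (v ⊕ o) + ∑[ v ∈ box n ] ∑[ o′ ∈ os ] h v (v ⊕ o′)
    ≡⟨ cong (_+ ∑[ v ∈ box n ] ∑[ o′ ∈ os ] h v (v ⊕ o′))
            (∑-cong (box n) λ v → cong (λ u → h u (v ⊕ o)) (sym (⊕-⊖ v o))) ⟩
  ∑[ v ∈ box n ] h ((v ⊕ o) ⊖ o) (v ⊕ o) + ∑[ v ∈ box n ] ∑[ o′ ∈ os ] h v (v ⊕ o′)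
    ≤⟨ +-mono-≤ (∑-box-⊕ n (λ s → h (s ⊖ o) s) ‖o‖≤1) (∑-box-double-count n h ‖os‖≤1) ⟩
  ∑[ s ∈ box (suc n) ] h (s ⊖ o) s + ∑[ s ∈ box (suc n) ] ∑[ o′ ∈ os ] h (s ⊖ o′) s
    ≡⟨ ∑-distrib-+ (box (suc n)) (λ s → h (s ⊖ o) s) (λ s → ∑[ o′ ∈ os ] h (s ⊖ o′) s) ⟨
  ∑[ s ∈ box (suc n) ] (h (s ⊖ o) s + ∑[ o′ ∈ os ] h (s ⊖ o′) s) ∎
  where open ≤-Reasoning

nbrSteps : List Pt
nbrSteps =
  (ℤ.-1ℤ , ℤ.-1ℤ) ∷ (ℤ.-1ℤ , ℤ.0ℤ) ∷ (ℤ.-1ℤ , ℤ.1ℤ) ∷ (ℤ.0ℤ , ℤ.-1ℤ) ∷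
  (ℤ.0ℤ , ℤ.1ℤ) ∷ (ℤ.1ℤ , ℤ.-1ℤ) ∷ (ℤ.1ℤ , ℤ.0ℤ) ∷ (ℤ.1ℤ , ℤ.1ℤ) ∷ []

closedSteps : List Pt
closedSteps = (ℤ.0ℤ , ℤ.0ℤ) ∷ nbrSteps

nbrSteps-unique : Unique nbrSteps
nbrSteps-unique = from-yes (unique? nbrSteps)

‖nbrSteps‖≡1 : All (λ o → ‖ o ‖ ≡ 1) nbrSteps
‖nbrSteps‖≡1 = refl ∷ refl ∷ refl ∷ refl ∷ refl ∷ refl ∷ refl ∷ refl ∷ []

‖closedSteps‖≤1 : All (λ o → ‖ o ‖ ≤ 1) closedSteps
‖closedSteps‖≤1 = z≤n ∷ All.map ≤-reflexive ‖nbrSteps‖≡1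

nbrs≡map-⊕ : ∀ v → nbrs v ≡ map (v ⊕_) nbrSteps
nbrs≡map-⊕ (a , b) rewrite ℤ.+-identityʳ a | ℤ.+-identityʳ b = refl

-- Defs speaks of s ∈ N(v) both through the list nbrs and through adjᵇ.
_∈N_ : Pt → Pt → Set
s ∈N v = s ∈ nbrs v × adjᵇ v s ≡ true

∈N-⊖ : ∀ s {o} → o ∈ nbrSteps → s ∈N (s ⊖ o)
∈N-⊖ s {o} o∈ =
  subst (_∈ nbrs (s ⊖ o)) (⊖-⊕ s o)
        (subst ((s ⊖ o) ⊕ o ∈_) (sym (nbrs≡map-⊕ (s ⊖ o))) (∈-map⁺ ((s ⊖ o) ⊕_) o∈)) ,
  cong (_≡ᵇ 1) (trans (‖v⊖o⊖v‖≡‖o‖ s o) (All.lookup ‖nbrSteps‖≡1 o∈))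

module Discharging {S : Subset} (D : IsDETLD S) where
  open IsDETLD D

  tight : Pt → Bool
  tight v = closedCount S v ≡ᵇ 2

  charge : Pt → ℕ
  charge v = 2 + toℕ (tight v)

  closedCount≡∑ : ∀ v → closedCount S v ≡ ∑[ o ∈ closedSteps ] toℕ (S (v ⊕ o))
  closedCount≡∑ v = cong₂ _+_ (cong (toℕ ∘ S) (sym (⊕-identityʳ v))) $ begin
    nbrCount S v                      ≡⟨ length-filter≡∑ S (nbrs v) ⟩
    ∑ (nbrs v) (toℕ ∘ S)              ≡⟨ cong (λ xs → ∑ xs (toℕ ∘ S)) (nbrs≡map-⊕ v) ⟩
    ∑ (map (v ⊕_) nbrSteps) (toℕ ∘ S) ≡⟨ ∑-map nbrSteps (v ⊕_) (toℕ ∘ S) ⟩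
    ∑[ o ∈ nbrSteps ] toℕ (S (v ⊕ o)) ∎
    where open ≡-Reasoning

  charge-sent : ∀ v → 6 ≤ charge v * closedCount S v
  charge-sent v = sent (closedCount S v) (dom v)
    where
    sent : ∀ c → 2 ≤ c → 6 ≤ (2 + toℕ (c ≡ᵇ 2)) * c
    sent 1                   (s≤s ())
    sent 2                   _ = ≤-refl
    sent (suc (suc (suc c))) _ = *-monoʳ-≤ 2 (m≤m+n 3 c)

  closedCount-tight : ∀ {v} → tight v ≡ true → closedCount S v ≡ 2
  closedCount-tight {v} t = ≡ᵇ⇒≡ (closedCount S v) 2 (Equivalence.from T-≡ t)

  nbrCount-tight-∉ : ∀ {v} → v ∉S S → tight v ≡ true → nbrCount S v ≡ 2
  nbrCount-tight-∉ {v} v∉S t = trans (cong (λ b → toℕ b + nbrCount S v) (sym v∉S)) (closedCount-tight t)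

  nbrCount-tight-∈ : ∀ {v} → v ∈S S → tight v ≡ true → nbrCount S v ≡ 1
  nbrCount-tight-∈ {v} v∈S t =
    suc-injective (trans (cong (λ b → toℕ b + nbrCount S v) (sym v∈S)) (closedCount-tight t))

  diffCount<nbrCount : ∀ {s u v} → s ∈S S → s ∈N v → s ∈N u → diffCount S v u < nbrCount S v
  diffCount<nbrCount {s} {u} {v} s∈S (s∈Nv , _) (_ , u∼s) = subst₂ _<_
    (sym (length-filter≡∑ (λ w → S w ∧ not (adjᵇ u w)) (nbrs v)))
    (sym (length-filter≡∑ S (nbrs v)))
    (∑-toℕ-∧-not< S (adjᵇ u) s∈Nv s∈S u∼s)

  tight-∉-unique : ∀ {s u v} → s ∈S S → s ∈N u → s ∈N v → u ∉S S → v ∉S S →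
                   tight u ≡ true → tight v ≡ true → u ≡ v
  tight-∉-unique {s} {u} {v} s∈S s∈Nu s∈Nv u∉S v∉S tu tv with u ≟ₚ v
  ... | yes u≡v = u≡v
  ... | no u≢v with sep₃ u v u∉S v∉S u≢v
  ...   | inj₁ 2≤dᵥᵤ = contradiction 2≤dᵥᵤ
          (<⇒≱ (subst (diffCount S v u <_) (nbrCount-tight-∉ v∉S tv) (diffCount<nbrCount s∈S s∈Nv s∈Nu)))
  ...   | inj₂ 2≤dᵤᵥ = contradiction 2≤dᵤᵥ
          (<⇒≱ (subst (diffCount S u v <_) (nbrCount-tight-∉ u∉S tu) (diffCount<nbrCount s∈S s∈Nu s∈Nv)))

  tight-∈-unique : ∀ {s u v} → s ∈S S → s ∈N u → s ∈N v → u ∈S S → v ∈S S →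
                   tight u ≡ true → tight v ≡ true → u ≡ v
  tight-∈-unique {s} {u} {v} s∈S s∈Nu s∈Nv u∈S v∈S tu tv with u ≟ₚ v
  ... | yes u≡v = u≡v
  ... | no u≢v = contradiction (≤-trans (sep₁ u v u∈S v∈S u≢v) (+-mono-≤ dᵥᵤ≤0 dᵤᵥ≤0)) λ ()
    where
    dᵥᵤ≤0 : diffCount S v u ≤ 0
    dᵥᵤ≤0 = s≤s⁻¹ (subst (diffCount S v u <_) (nbrCount-tight-∈ v∈S tv)
                          (diffCount<nbrCount s∈S s∈Nv s∈Nu))
    dᵤᵥ≤0 : diffCount S u v ≤ 0
    dᵤᵥ≤0 = s≤s⁻¹ (subst (diffCount S u v <_) (nbrCount-tight-∈ u∈S tu)
                          (diffCount<nbrCount s∈S s∈Nu s∈Nv))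

  toℕ-tight-split : ∀ w → toℕ (tight w) ≡ toℕ (not (S w) ∧ tight w) + toℕ (S w ∧ tight w)
  toℕ-tight-split w with S w
  ... | true  = refl
  ... | false = sym (+-identityʳ _)

  ∑-tight-neighbours≤2 : ∀ {s} → s ∈S S → ∑[ o ∈ nbrSteps ] toℕ (tight (s ⊖ o)) ≤ 2
  ∑-tight-neighbours≤2 {s} s∈S = begin
    ∑[ o ∈ nbrSteps ] toℕ (tight (s ⊖ o))
      ≡⟨ ∑-cong nbrSteps (λ o → toℕ-tight-split (s ⊖ o)) ⟩
    ∑[ o ∈ nbrSteps ] (toℕ (outside o) + toℕ (inside o))
      ≡⟨ ∑-distrib-+ nbrSteps (toℕ ∘ outside) (toℕ ∘ inside) ⟩
    ∑ nbrSteps (toℕ ∘ outside) + ∑ nbrSteps (toℕ ∘ inside)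
      ≤⟨ +-mono-≤ (∑-toℕ≤1 outside nbrSteps nbrSteps-unique outside-unique)
                  (∑-toℕ≤1 inside nbrSteps nbrSteps-unique inside-unique) ⟩
    2 ∎
    where
    open ≤-Reasoning
    outside inside : Pt → Bool
    outside o = not (S (s ⊖ o)) ∧ tight (s ⊖ o)
    inside  o = S (s ⊖ o) ∧ tight (s ⊖ o)
    outside-unique : ∀ {o o′} → o ∈ nbrSteps → o′ ∈ nbrSteps →
                     outside o ≡ true → outside o′ ≡ true → o ≡ o′
    outside-unique o∈ o′∈ out out′ with ∧≡true out | ∧≡true out′
    ... | out₁ , t | out₂ , t′ =
      ⊖-injectiveʳ s (tight-∉-unique s∈S (∈N-⊖ s o∈) (∈N-⊖ s o′∈)
                                     (not≡true out₁) (not≡true out₂) t t′)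
    inside-unique : ∀ {o o′} → o ∈ nbrSteps → o′ ∈ nbrSteps →
                    inside o ≡ true → inside o′ ≡ true → o ≡ o′
    inside-unique o∈ o′∈ ins ins′ with ∧≡true ins | ∧≡true ins′
    ... | in₁ , t | in₂ , t′ =
      ⊖-injectiveʳ s (tight-∈-unique s∈S (∈N-⊖ s o∈) (∈N-⊖ s o′∈) in₁ in₂ t t′)

  charge-received : ∀ {s} → s ∈S S → ∑[ o ∈ closedSteps ] charge (s ⊖ o) ≤ 21
  charge-received {s} s∈S = begin
    ∑[ o ∈ closedSteps ] charge (s ⊖ o)
      ≡⟨ ∑-distrib-+ closedSteps (λ _ → 2) (λ o → toℕ (tight (s ⊖ o))) ⟩
    18 + (toℕ (tight (s ⊖ (ℤ.0ℤ , ℤ.0ℤ))) + ∑[ o ∈ nbrSteps ] toℕ (tight (s ⊖ o)))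
      ≤⟨ +-monoʳ-≤ 18 (+-mono-≤ (toℕ≤1 (tight (s ⊖ (ℤ.0ℤ , ℤ.0ℤ)))) (∑-tight-neighbours≤2 s∈S)) ⟩
    21 ∎
    where open ≤-Reasoning

  charge-received-toℕ : ∀ s → ∑[ o ∈ closedSteps ] (charge (s ⊖ o) * toℕ (S s)) ≤ 21 * toℕ (S s)
  charge-received-toℕ s rewrite ∑-*ʳ closedSteps (toℕ (S s)) (λ o → charge (s ⊖ o))
    with S s in s∈S
  ...   | true  = *-monoˡ-≤ 1 (charge-received s∈S)
  ...   | false = ≤-reflexive (*-zeroʳ (∑[ o ∈ closedSteps ] charge (s ⊖ o)))

  6*boxSize≤21*countIn : ∀ n → 6 * boxSize n ≤ 21 * countIn S (suc n)
  6*boxSize≤21*countIn n = begin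
    6 * boxSize n
      ≡⟨ ∑-box-const n 6 ⟨
    ∑[ v ∈ box n ] 6
      ≤⟨ ∑-mono-≤ (box n) charge-sent ⟩
    ∑[ v ∈ box n ] (charge v * closedCount S v)
      ≡⟨ ∑-cong (box n) charge-spread ⟩
    ∑[ v ∈ box n ] ∑[ o ∈ closedSteps ] (charge v * toℕ (S (v ⊕ o)))
      ≤⟨ ∑-box-double-count n (λ v s → charge v * toℕ (S s)) ‖closedSteps‖≤1 ⟩
    ∑[ s ∈ box (suc n) ] ∑[ o ∈ closedSteps ] (charge (s ⊖ o) * toℕ (S s))
      ≤⟨ ∑-mono-≤ (box (suc n)) charge-received-toℕ ⟩
    ∑[ s ∈ box (suc n) ] (21 * toℕ (S s))
      ≡⟨ ∑-*ˡ (box (suc n)) 21 (toℕ ∘ S) ⟩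
    21 * ∑ (box (suc n)) (toℕ ∘ S)
      ≡⟨ cong (21 *_) (length-filter≡∑ S (box (suc n))) ⟨
    21 * countIn S (suc n) ∎
    where
    open ≤-Reasoning
    charge-spread : ∀ v → charge v * closedCount S v ≡ ∑[ o ∈ closedSteps ] (charge v * toℕ (S (v ⊕ o)))
    charge-spread v = trans (cong (charge v *_) (closedCount≡∑ v))
                            (sym (∑-*ˡ closedSteps (charge v) (λ o → toℕ (S (v ⊕ o)))))

densityAtLeast-eventually : ∀ {S} p q n₀ → (∀ j → p * boxSize (n₀ + j) ≤ q * countIn S (n₀ + j)) →
                            DensityAtLeast S p q
densityAtLeast-eventually {S} p q n₀ bound k N = n₀ + N , m≤n+m N n₀ , (begin
  p * suc k * b         ≡⟨ xy∙z≈y∙xz p (suc k) b ⟩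
  suc k * (p * b)       ≤⟨ *-monoʳ-≤ (suc k) (bound N) ⟩
  suc k * (q * c)       ≡⟨ xy∙z≈y∙xz q (suc k) c ⟨
  q * suc k * c         ≤⟨ m≤m+n _ (q * b) ⟩
  q * suc k * c + q * b ∎)
  where
  open ≤-Reasoning
  b = boxSize (n₀ + N)
  c = countIn S (n₀ + N)

63*boxSize-suc≤66*boxSize : ∀ j → 63 * boxSize (suc (42 + j)) ≤ 66 * boxSize (42 + j)
63*boxSize-suc≤66*boxSize j = subst (63 * boxSize (suc (42 + j)) ≤_) (sym (expand j)) (m≤m+n _ _)
  where
  expand : ∀ j → 66 * ((1 + 2 * (42 + j)) * (1 + 2 * (42 + j)))
               ≡ 63 * ((1 + 2 * (1 + (42 + j))) * (1 + 2 * (1 + (42 + j)))) + (3 + 516 * j + 12 * (j * j))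
  expand = ℕ-Solver.solve-∀

corollary4 : ∀ (S : Subset) → IsDETLD S → DensityAtLeast S 3 11
corollary4 S D = densityAtLeast-eventually {S} 3 11 43 λ j → *-cancelˡ-≤ 21 (begin
  21 * (3 * boxSize (43 + j))    ≡⟨ *-assoc 21 3 (boxSize (43 + j)) ⟨
  63 * boxSize (suc (42 + j))    ≤⟨ 63*boxSize-suc≤66*boxSize j ⟩
  66 * boxSize (42 + j)          ≡⟨ *-assoc 11 6 (boxSize (42 + j)) ⟩
  11 * (6 * boxSize (42 + j))    ≤⟨ *-monoʳ-≤ 11 (6*boxSize≤21*countIn (42 + j)) ⟩
  11 * (21 * countIn S (43 + j)) ≡⟨ x∙yz≈y∙xz 11 21 (countIn S (43 + j)) ⟩
  21 * (11 * countIn S (43 + j)) ∎)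
  where
  open Discharging D
  open ≤-Reasoning
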